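{- Let $\sigma\in\mathfrak S_n$. The number of descents of $\sigma$ (positions $j$ with $\sigma(j)>\sigma(j+1)$) equals the number of distinct nonzero values among the entries of $\operatorname{Sc}(\sigma)$.
   Context: Permutations are words $\sigma=\sigma(1)\cdots\sigma(n)$. Saillance code: $\operatorname{Sc}(\sigma)=(a_1,\ldots,a_n)$ where, if some letter greater than $i$ lies to the left of $i$ in $\sigma$ and $b$ is the rightmost such letter, $a_i=n+1-b$ (the number of letters of $\sigma$ that are $\ge b$); otherwise $a_i=0$. -}

module Defs where

open import Data.Nat using (ℕ; zero; suc; _∸_; _<_; _<?_; _≟_)
open import Data.Fin using (Fin; toℕ; fromℕ<)
open import Data.Fin.Permutation using (Permutation′; _⟨$⟩ʳ_; _⟨$⟩ˡ_)
open import Data.List using (List; []; _∷_; filter; length; map; deduplicate; upTo; allFin; last)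
open import Data.Maybe using (Maybe; just; nothing)
open import Relation.Nullary.Decidable using (¬?; yes; no)

-- Positions and letters are 0-based here: the letter
-- v : Fin n stands for the paper's letter toℕ v + 1 (a shift that preserves
-- all comparisons).

-- the word of σ as a function on ℕ (value irrelevant outside 0..n-1)
word : ∀ {n} → Permutation′ n → ℕ → ℕ
word {n} σ k with k <? n
... | yes k<n = toℕ (σ ⟨$⟩ʳ fromℕ< k<n)
... | no _ = 0

des : ∀ {n} → Permutation′ n → ℕ
des {n} σ = length (filter (λ j → word σ (suc j) <? word σ j) (upTo (n ∸ 1)))

-- Saillance code entry for the letter v:
-- positions p to the left of the position of v carrying a letter > v;
-- b is the letter at the rightmost such position; entry = number of
-- letters ≥ b, i.e. n - (0-based value of b).
scEntry : ∀ {n} → Permutation′ n → Fin n → ℕ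
scEntry {n} σ v with last (filter (λ p → toℕ v <? word σ p)
                              (filter (λ p → p <? toℕ (σ ⟨$⟩ˡ v)) (upTo n)))
... | nothing = 0
... | just p = n ∸ word σ p

Sc : ∀ {n} → Permutation′ n → List ℕ
Sc {n} σ = map (scEntry σ) (allFin n)

distinctNonzero : List ℕ → ℕ
distinctNonzero xs = length (deduplicate _≟_ (filter (λ x → ¬? (x ≟ 0)) xs))

-- A descent at position j contributes the code value #{letters ≥ σ(j)}: the
-- letter σ(j+1) right after it sees σ(j) as the rightmost larger letter to its
-- left.  Conversely, if b at position p is the rightmost letter left of v that
-- exceeds v, then the letter at p+1 does not exceed v (it is v itself, or else
-- it would be a larger letter further right), so p is a descent and v's code
-- value is the one p contributes.
-- Distinct descents contribute distinct values because σ is injective.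
module Submission where

open import Defs
open import Data.Nat using (ℕ)
open import Data.Fin.Permutation using (Permutation′)
open import Relation.Binary.PropositionalEquality using (_≡_)

open import Data.Nat using (zero; suc; pred; _∸_; _<_; _≤_; _<?_; _≟_; z≤n; s≤s; s≤s⁻¹)
open import Data.Nat.Properties
open import Data.Fin using (Fin; toℕ; fromℕ<)
open import Data.Fin.Properties using (toℕ<n; toℕ-fromℕ<; fromℕ<-toℕ; toℕ-injective)
open import Data.Fin.Permutation using (_⟨$⟩ʳ_; _⟨$⟩ˡ_; inverseˡ; inverseʳ)
open import Data.List using (List; []; _∷_; _∷ʳ_; _++_; filter; length; map; deduplicate; upTo; last)
open import Data.List.Properties using (filter-++; filter-accept; filter-reject; filter-all; upTo-∷ʳ; length-map; ++-identityʳ)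
open import Data.List.Membership.Propositional using (_∈_)
open import Data.List.Membership.Propositional.Properties
  using (∈-map⁺; ∈-map⁻; ∈-filter⁺; ∈-filter⁻; ∈-upTo⁺; ∈-upTo⁻; ∈-allFin; ∈-deduplicate⁺; ∈-deduplicate⁻)
open import Data.List.Membership.Propositional.Properties.WithK using (unique∧set⇒bag)
open import Data.List.Relation.Binary.BagAndSetEquality using (∼bag⇒↭)
open import Data.List.Relation.Binary.Permutation.Propositional.Properties using (↭-length)
import Data.List.Relation.Unary.All as All
open import Data.List.Relation.Unary.Unique.Propositional using (Unique)
import Data.List.Relation.Unary.AllPairs.Properties as AllPairs
import Data.List.Relation.Unary.Unique.DecPropositional.Properties as UniqueDec
open import Data.Maybe using (Maybe; just; nothing; maybe′)
open import Data.Product using (_×_; _,_; ∃-syntax)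
open import Data.Sum using (inj₁; inj₂)
open import Function.Bundles using (_⇔_; mk⇔; Equivalence)
open import Relation.Binary.Definitions using (DecidableEquality)
open import Relation.Binary.PropositionalEquality using (refl; sym; trans; cong; subst; _≢_; module ≡-Reasoning)
open import Relation.Nullary using (¬_; yes; no; contradiction)
open import Relation.Nullary.Decidable using (¬?)
open import Relation.Unary using (Pred; Decidable)

last-∷ʳ : ∀ {A : Set} (xs : List A) x → last (xs ∷ʳ x) ≡ just x
last-∷ʳ []           x = refl
last-∷ʳ (_ ∷ [])     x = refl
last-∷ʳ (_ ∷ y ∷ xs) x = last-∷ʳ (y ∷ xs) x

module _ {ℓ} {P : Pred ℕ ℓ} (P? : Decidable P) where

  filter-upTo-suc-accept : ∀ {m} → P m → filter P? (upTo (suc m)) ≡ filter P? (upTo m) ∷ʳ m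
  filter-upTo-suc-accept {m} pm = begin
    filter P? (upTo (suc m))                 ≡⟨ cong (filter P?) (upTo-∷ʳ m) ⟨
    filter P? (upTo m ∷ʳ m)                  ≡⟨ filter-++ P? (upTo m) (m ∷ []) ⟩
    filter P? (upTo m) ++ filter P? (m ∷ []) ≡⟨ cong (filter P? (upTo m) ++_) (filter-accept P? pm) ⟩
    filter P? (upTo m) ∷ʳ m                  ∎
    where
    open ≡-Reasoning

  filter-upTo-suc-reject : ∀ {m} → ¬ P m → filter P? (upTo (suc m)) ≡ filter P? (upTo m)
  filter-upTo-suc-reject {m} ¬pm = begin
    filter P? (upTo (suc m))                 ≡⟨ cong (filter P?) (upTo-∷ʳ m) ⟨
    filter P? (upTo m ∷ʳ m)                  ≡⟨ filter-++ P? (upTo m) (m ∷ []) ⟩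
    filter P? (upTo m) ++ filter P? (m ∷ []) ≡⟨ cong (filter P? (upTo m) ++_) (filter-reject P? ¬pm) ⟩
    filter P? (upTo m) ++ []                 ≡⟨ ++-identityʳ (filter P? (upTo m)) ⟩
    filter P? (upTo m)                       ∎
    where
    open ≡-Reasoning

  last-filter-upTo-accept : ∀ {m} → P m → last (filter P? (upTo (suc m))) ≡ just m
  last-filter-upTo-accept {m} pm = trans (cong last (filter-upTo-suc-accept pm)) (last-∷ʳ (filter P? (upTo m)) m)

  last-filter-upTo : ∀ m {p} → last (filter P? (upTo m)) ≡ just p →
                     P p × p < m × (∀ {q} → p < q → q < m → ¬ P q)
  last-filter-upTo zero ()
  last-filter-upTo (suc m) eq with P? m
  ... | yes pm with trans (sym (last-filter-upTo-accept pm)) eq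
  ...   | refl = pm , ≤-refl , λ m<q q<1+m _ → <⇒≱ m<q (s≤s⁻¹ q<1+m)
  last-filter-upTo (suc m) {p} eq | no ¬pm
    with last-filter-upTo m (trans (sym (cong last (filter-upTo-suc-reject ¬pm))) eq)
  ... | pp , p<m , none = pp , m<n⇒m<1+n p<m , none′
    where
    none′ : ∀ {q} → p < q → q < suc m → ¬ P q
    none′ p<q q<1+m with m≤n⇒m<n∨m≡n (s≤s⁻¹ q<1+m)
    ... | inj₁ q<m  = none p<q q<m
    ... | inj₂ refl = ¬pm

filter-<-upTo : ∀ {k n} → k ≤ n → filter (_<? k) (upTo n) ≡ upTo k
filter-<-upTo {zero} {zero} z≤n = refl
filter-<-upTo {k} {suc n} k≤1+n with m≤n⇒m<n∨m≡n k≤1+n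
... | inj₁ k<1+n =
  trans (filter-upTo-suc-reject (_<? k) (≤⇒≯ (s≤s⁻¹ k<1+n))) (filter-<-upTo (s≤s⁻¹ k<1+n))
... | inj₂ refl  = filter-all (_<? k) (All.tabulate ∈-upTo⁻)

m<pred[n]⇒suc[m]<n : ∀ {m n} → m < pred n → suc m < n
m<pred[n]⇒suc[m]<n {n = suc _} = s≤s

module _ {A : Set} (_≟ᴬ_ : DecidableEquality A) where

  length-deduplicate : ∀ {xs ys : List A} → Unique xs → (∀ {x} → x ∈ xs ⇔ x ∈ ys) →
                       length xs ≡ length (deduplicate _≟ᴬ_ ys)
  length-deduplicate {xs} {ys} xs! xs≈ys =
    ↭-length (∼bag⇒↭ (unique∧set⇒bag xs! (UniqueDec.deduplicate-! _≟ᴬ_ ys) xs≈dedup))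
    where
    xs≈dedup : ∀ {x} → x ∈ xs ⇔ x ∈ deduplicate _≟ᴬ_ ys
    xs≈dedup = mk⇔ (λ x∈xs → ∈-deduplicate⁺ _≟ᴬ_ (Equivalence.to xs≈ys x∈xs))
                   (λ x∈dedup → Equivalence.from xs≈ys (∈-deduplicate⁻ _≟ᴬ_ ys x∈dedup))

module _ {n : ℕ} (σ : Permutation′ n) where

  word-toℕ : ∀ i → word σ (toℕ i) ≡ toℕ (σ ⟨$⟩ʳ i)
  word-toℕ i with toℕ i <? n
  ... | yes i<n = cong (λ j → toℕ (σ ⟨$⟩ʳ j)) (fromℕ<-toℕ i i<n)
  ... | no  i≮n = contradiction (toℕ<n i) i≮n

  word-fromℕ< : ∀ {k} (k<n : k < n) → word σ k ≡ toℕ (σ ⟨$⟩ʳ fromℕ< k<n)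
  word-fromℕ< {k} k<n = trans (cong (word σ) (sym (toℕ-fromℕ< k<n))) (word-toℕ (fromℕ< k<n))

  word-< : ∀ {k} → k < n → word σ k < n
  word-< k<n = subst (_< n) (sym (word-fromℕ< k<n)) (toℕ<n _)

  word-injective : ∀ {j k} → j < n → k < n → word σ j ≡ word σ k → j ≡ k
  word-injective {j} {k} j<n k<n eq = begin
    j                        ≡⟨ toℕ-fromℕ< j<n ⟨
    toℕ (fromℕ< j<n)         ≡⟨ cong toℕ (inverseˡ σ) ⟨
    toℕ (σ ⟨$⟩ˡ (σ ⟨$⟩ʳ fromℕ< j<n)) ≡⟨ cong (λ i → toℕ (σ ⟨$⟩ˡ i)) σj≡σk ⟩
    toℕ (σ ⟨$⟩ˡ (σ ⟨$⟩ʳ fromℕ< k<n)) ≡⟨ cong toℕ (inverseˡ σ) ⟩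
    toℕ (fromℕ< k<n)         ≡⟨ toℕ-fromℕ< k<n ⟩
    k                        ∎
    where
    open ≡-Reasoning
    σj≡σk : σ ⟨$⟩ʳ fromℕ< j<n ≡ σ ⟨$⟩ʳ fromℕ< k<n
    σj≡σk = toℕ-injective (trans (sym (word-fromℕ< j<n)) (trans eq (word-fromℕ< k<n)))

  position : Fin n → ℕ
  position v = toℕ (σ ⟨$⟩ˡ v)

  position<n : ∀ v → position v < n
  position<n v = toℕ<n (σ ⟨$⟩ˡ v)

  word-position : ∀ v → word σ (position v) ≡ toℕ v
  word-position v = trans (word-toℕ (σ ⟨$⟩ˡ v)) (cong toℕ (inverseʳ σ))

  larger? : (v : Fin n) → Decidable (λ p → toℕ v < word σ p)
  larger? v p = toℕ v <? word σ p

  rightmostLarger : Fin n → Maybe ℕ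
  rightmostLarger v = last (filter (larger? v) (upTo (position v)))

  descentValue : ℕ → ℕ
  descentValue j = n ∸ word σ j

  scEntry-rightmostLarger : ∀ v → scEntry σ v ≡ maybe′ descentValue 0 (rightmostLarger v)
  scEntry-rightmostLarger v =
    trans scEntry-last (cong (λ ps → maybe′ descentValue 0 (last (filter (larger? v) ps)))
                             (filter-<-upTo (<⇒≤ (position<n v))))
    where
    scEntry-last : scEntry σ v ≡ maybe′ descentValue 0
      (last (filter (λ p → toℕ v <? word σ p) (filter (λ p → p <? toℕ (σ ⟨$⟩ˡ v)) (upTo n))))
    scEntry-last with last (filter (λ p → toℕ v <? word σ p) (filter (λ p → p <? toℕ (σ ⟨$⟩ˡ v)) (upTo n)))
    ... | nothing = refl
    ... | just p  = refl

  descent? : Decidable (λ j → word σ (suc j) < word σ j)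
  descent? j = word σ (suc j) <? word σ j

  descents : List ℕ
  descents = filter descent? (upTo (n ∸ 1))

  scEntry-after-descent : ∀ {j} (1+j<n : suc j < n) → word σ (suc j) < word σ j →
                          scEntry σ (σ ⟨$⟩ʳ fromℕ< 1+j<n) ≡ descentValue j
  scEntry-after-descent {j} 1+j<n descent = begin
    scEntry σ v                                 ≡⟨ scEntry-rightmostLarger v ⟩
    maybe′ descentValue 0 (rightmostLarger v)   ≡⟨ cong (maybe′ descentValue 0) rightmostLarger≡j ⟩
    descentValue j                              ∎
    where
    open ≡-Reasoning
    v : Fin n
    v = σ ⟨$⟩ʳ fromℕ< 1+j<n
    position≡1+j : position v ≡ suc j
    position≡1+j = trans (cong toℕ (inverseˡ σ)) (toℕ-fromℕ< 1+j<n)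
    v<σj : toℕ v < word σ j
    v<σj = subst (_< word σ j) (word-fromℕ< 1+j<n) descent
    rightmostLarger≡j : rightmostLarger v ≡ just j
    rightmostLarger≡j = trans (cong (λ m → last (filter (larger? v) (upTo m))) position≡1+j)
                              (last-filter-upTo-accept (larger? v) v<σj)

  scEntry-nonzero⇒descent : ∀ v → scEntry σ v ≢ 0 →
                            ∃[ j ] j ∈ descents × scEntry σ v ≡ descentValue j
  scEntry-nonzero⇒descent v entry≢0 with rightmostLarger v in eq
  ... | nothing = contradiction (trans (scEntry-rightmostLarger v) (cong (maybe′ descentValue 0) eq)) entry≢0
  ... | just p with last-filter-upTo (larger? v) (position v) eq
  ...   | v<σp , p<position , noneLarger =
    p , ∈-filter⁺ descent? (∈-upTo⁺ p<n∸1) descent ,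
    trans (scEntry-rightmostLarger v) (cong (maybe′ descentValue 0) eq)
    where
    p<n∸1 : p < n ∸ 1
    p<n∸1 = suc[m]≤n⇒m≤pred[n] (≤-<-trans p<position (position<n v))
    σ[1+p]≤v : word σ (suc p) ≤ toℕ v
    σ[1+p]≤v with m≤n⇒m<n∨m≡n p<position
    ... | inj₁ 1+p<position = ≮⇒≥ (noneLarger (n<1+n p) 1+p<position)
    ... | inj₂ 1+p≡position = ≤-reflexive (trans (cong (word σ) 1+p≡position) (word-position v))
    descent : word σ (suc p) < word σ p
    descent = ≤-<-trans σ[1+p]≤v v<σp

  descentValue-injective : ∀ {j k} → j < n → k < n → descentValue j ≡ descentValue k → j ≡ k
  descentValue-injective j<n k<n eq =
    word-injective j<n k<n (∸-cancelˡ-≡ (<⇒≤ (word-< j<n)) (<⇒≤ (word-< k<n)) eq)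

  descentValues-unique : Unique (map descentValue descents)
  descentValues-unique =
    AllPairs.map⁺ (AllPairs.filter⁺ descent? (AllPairs.applyUpTo⁺₁ (λ j → j) (n ∸ 1) distinct))
    where
    distinct : ∀ {i j} → i < j → j < n ∸ 1 → descentValue i ≢ descentValue j
    distinct {j = j} i<j j<n∸1 eq = <⇒≢ i<j (descentValue-injective (<-trans i<j j<n) j<n eq)
      where
      j<n : j < n
      j<n = <-≤-trans j<n∸1 pred[n]≤n

  nonzero? : Decidable (λ x → x ≢ 0)
  nonzero? x = ¬? (x ≟ 0)

  ∈-descentValues⇔∈-nonzeroSc : ∀ {x} → x ∈ map descentValue descents ⇔ x ∈ filter nonzero? (Sc σ)
  ∈-descentValues⇔∈-nonzeroSc = mk⇔ to from
    where
    to : ∀ {x} → x ∈ map descentValue descents → x ∈ filter nonzero? (Sc σ)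
    to x∈ with ∈-map⁻ descentValue x∈
    ... | j , j∈descents , refl with ∈-filter⁻ descent? {xs = upTo (n ∸ 1)} j∈descents
    ...   | j∈upTo , descent = ∈-filter⁺ nonzero? value∈Sc (>⇒≢ (m<n⇒0<n∸m (word-< j<n)))
      where
      1+j<n : suc j < n
      1+j<n = m<pred[n]⇒suc[m]<n (∈-upTo⁻ j∈upTo)
      j<n : j < n
      j<n = <-trans (n<1+n j) 1+j<n
      value∈Sc : descentValue j ∈ Sc σ
      value∈Sc = subst (_∈ Sc σ) (scEntry-after-descent 1+j<n descent) (∈-map⁺ (scEntry σ) (∈-allFin _))
    from : ∀ {x} → x ∈ filter nonzero? (Sc σ) → x ∈ map descentValue descents
    from x∈ with ∈-filter⁻ nonzero? {xs = Sc σ} x∈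
    ... | x∈Sc , x≢0 with ∈-map⁻ (scEntry σ) x∈Sc
    ...   | v , _ , refl with scEntry-nonzero⇒descent v x≢0
    ...     | j , j∈descents , entry≡ =
      subst (_∈ map descentValue descents) (sym entry≡) (∈-map⁺ descentValue j∈descents)

mainTheorem7 : (n : ℕ) (σ : Permutation′ n) → des σ ≡ distinctNonzero (Sc σ)
mainTheorem7 n σ = begin
  length (descents σ)                        ≡⟨ length-map (descentValue σ) (descents σ) ⟨
  length (map (descentValue σ) (descents σ)) ≡⟨ length-deduplicate _≟_ (descentValues-unique σ)
                                                                       (∈-descentValues⇔∈-nonzeroSc σ) ⟩
  distinctNonzero (Sc σ)                     ∎
  where
  open ≡-Reasoning
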